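{- Let $\mathbb{A}=(A,\le,\to,\Sigma)$ be an implicative algebra with $|A|<\kappa$ for a strongly inaccessible cardinal $\kappa$, and let $\mathbf{W}$ and the interpretation $\|\cdot\|$ be as in the context. Let $\varphi[\underline{x}]$ and $\psi[\underline{x}]$ be formulas in context of the language of set theory, with $\underline{x}$ of length $n$. If $\psi$ is derivable from $\varphi$ in first-order intuitionistic logic with equality (in context $\underline{x}$), then $\|\varphi[\underline{x}]\|\vdash_{\Sigma[\mathbf{W}^n]}\|\psi[\underline{x}]\|$. If moreover $\mathbb{A}$ is classical and $\psi$ is derivable from $\varphi$ in first-order classical logic with equality (in context $\underline{x}$), then $\|\varphi[\underline{x}]\|\vdash_{\Sigma[\mathbf{W}^n]}\|\psi[\underline{x}]\|$.
   Context: An implicative algebra is a quadruple $\mathbb{A}=(A,\le,\to,\Sigma)$ where $(A,\le)$ is a complete lattice; $\to:A\times A\to A$ is anti-monotone in its first and monotone in its second argument and satisfies $a\to\bigwedge_{i}b_i=\bigwedge_{i}(a\to b_i)$; and $\Sigma\subseteq A$ is upward closed, closed under modus ponens, and contains $\mathbf{K}=\bigwedge_{a,b}(a\to(b\to a))$ and $\mathbf{S}=\bigwedge_{a,b,c}((a\to(b\to c))\to((a\to b)\to(a\to c)))$. $\mathbb{A}$ is classical if $\bigwedge_{a,b}(((a\to b)\to a)\to a)\in\Sigma$. Define $a\times b:=\bigwedge_{x}((a\to(b\to x))\to x)$, $a+b:=\bigwedge_x((a\to x)\to((b\to x)\to x))$, $\exists_{i\in I}a_i:=\bigwedge_x(\bigwedge_i(a_i\to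 x)\to x)$. For maps $f,g:I\to A$, $f\vdash_{\Sigma[I]}g$ means $\bigwedge_{i\in I}(f(i)\to g(i))\in\Sigma$. Work in ZFC with $\kappa$ strongly inaccessible and $|A|<\kappa$. With $\mathsf{Part}(X,Y)$ the set of partial functions $X\rightharpoonup Y$ and $\partial_0(f)$ the domain of $f$, let $W_0=\emptyset$, $W_{\beta+1}=\mathsf{Part}(W_\beta,A)$, $W_\lambda=\bigcup_{\beta<\lambda}W_\beta$ for limits, $\mathbf{W}=W_\kappa$. By simultaneous recursion on ranks: $\alpha\in_{\mathbf{W}}\beta:=\exists_{t\in\partial_0(\beta)}(\beta(t)\times(t=_{\mathbf{W}}\alpha))$, $\alpha=_{\mathbf{W}}\beta:=(\alpha\subseteq_{\mathbf{W}}\beta)\times(\beta\subseteq_{\mathbf{W}}\alpha)$, $\alpha\subseteq_{\mathbf{W}}\beta:=\bigwedge_{t\in\partial_0(\alpha)}(\alpha(t)\to t\in_{\mathbf{W}}\beta)$. The language of set theory has only variables as terms, binary predicates $=,\in$, connectives $\bot,\wedge,\vee,\to$, quantifiers $\exists,\forall$. To each formula in context $\varphi[x_1,\dots,x_n]$ one assigns $\|\varphi[\underline{x}]\|:\mathbf{W}^n\to A$ by: $\|x_i\in x_j\|(\underline\alpha)=\alpha_i\in_{\mathbf{W}}\alpha_j$; $\|x_i=x_j\|(\underline\alpha)=\alpha_i=_{\mathbf{W}}\alpha_j$; $\|\bot\|=\bot$; $\|\varphi\wedge\psi\|=\|\varphi\|\times\|\psi\|$, $\|\varphi\vee\psi\|=\|\varphi\|+\|\psi\|$,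 $\|\varphi\to\psi\|=\|\varphi\|\to\|\psi\|$ pointwise; $\|\exists y\varphi[\underline{x}]\|(\underline\alpha)=\exists_{\beta\in\mathbf{W}}\|\varphi[\underline{x},y]\|(\underline\alpha,\beta)$; $\|\forall y\varphi[\underline{x}]\|(\underline\alpha)=\bigwedge_{\beta\in\mathbf{W}}\|\varphi[\underline{x},y]\|(\underline\alpha,\beta)$. -}

module Defs where

open import Level using (Level; Lift; lift; lower) renaming (suc to lsuc; zero to lzero)
open import Data.Nat using (ℕ; zero; suc)
open import Data.Fin using (Fin; zero; suc)
open import Data.Product using (_,_)
open import Data.List using (List; []; _∷_; [_]; map)
open import Data.List.Membership.Propositional using () renaming (_∈_ to _∈ᴸ_)
open import Relation.Binary.PropositionalEquality using (_≡_)
open import Relation.Binary.Structures using (IsPartialOrder)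

-- Size convention: the universe Set plays the role of
-- V_κ (κ strongly inaccessible).  The carrier A lives in Set (|A| < κ);
-- the model W lives in Set₁, and the complete lattice has meets of all
-- families indexed by types in Set₁ (in particular of all families
-- indexed by W, W^n, A, subsets of A, ...).

record ImplicativeStructure : Set₂ where
  infixr 5 _⇒_
  infix 4 _≤_
  field
    Carrier      : Set
    _≤_          : Carrier → Carrier → Set
    ≤-isPartialOrder : IsPartialOrder _≡_ _≤_
    ⋀            : {I : Set₁} → (I → Carrier) → Carrier
    ⋀-lower      : {I : Set₁} (f : I → Carrier) (i : I) → ⋀ f ≤ f i
    ⋀-greatest   : {I : Set₁} (f : I → Carrier) (c : Carrier) →
                   ((i : I) → c ≤ f i) → c ≤ ⋀ f
    _⇒_          : Carrier → Carrier → Carrier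
    ⇒-mono       : {a a′ b b′ : Carrier} → a′ ≤ a → b ≤ b′ → (a ⇒ b) ≤ (a′ ⇒ b′)
    ⇒-⋀          : {I : Set₁} (a : Carrier) (f : I → Carrier) →
                   (a ⇒ ⋀ f) ≡ ⋀ (λ i → a ⇒ f i)

  ⋀₀ : {I : Set} → (I → Carrier) → Carrier
  ⋀₀ {I} f = ⋀ {Lift (lsuc lzero) I} (λ i → f (lower i))

  ⊥ᴬ : Carrier
  ⊥ᴬ = ⋀₀ (λ (x : Carrier) → x)

  𝐊 : Carrier
  𝐊 = ⋀₀ λ a → ⋀₀ λ b → a ⇒ (b ⇒ a)

  𝐒 : Carrier
  𝐒 = ⋀₀ λ a → ⋀₀ λ b → ⋀₀ λ c →
        (a ⇒ (b ⇒ c)) ⇒ ((a ⇒ b) ⇒ (a ⇒ c))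

  𝐜𝐜 : Carrier
  𝐜𝐜 = ⋀₀ λ a → ⋀₀ λ b → ((a ⇒ b) ⇒ a) ⇒ a

  infixr 6 _×ᴬ_
  infixr 5 _+ᴬ_
  _×ᴬ_ : Carrier → Carrier → Carrier
  a ×ᴬ b = ⋀₀ λ x → (a ⇒ (b ⇒ x)) ⇒ x

  _+ᴬ_ : Carrier → Carrier → Carrier
  a +ᴬ b = ⋀₀ λ x → (a ⇒ x) ⇒ ((b ⇒ x) ⇒ x)

  ∃ᴬ : {I : Set₁} → (I → Carrier) → Carrier
  ∃ᴬ f = ⋀₀ λ x → ⋀ (λ i → f i ⇒ x) ⇒ x

  ∃ᴬ₀ : {I : Set} → (I → Carrier) → Carrier
  ∃ᴬ₀ {I} f = ∃ᴬ {Lift (lsuc lzero) I} (λ i → f (lower i))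

record ImplicativeAlgebra : Set₂ where
  field
    structure : ImplicativeStructure
  open ImplicativeStructure structure public
  field
    Sep     : Carrier → Set
    Sep-up  : {a b : Carrier} → a ≤ b → Sep a → Sep b
    Sep-mp  : {a b : Carrier} → Sep (a ⇒ b) → Sep a → Sep b
    Sep-K   : Sep 𝐊
    Sep-S   : Sep 𝐒

Classical : ImplicativeAlgebra → Set
Classical 𝔸 = ImplicativeAlgebra.Sep 𝔸 (ImplicativeAlgebra.𝐜𝐜 𝔸)

infix  7 _≐_ _∈̇_
infixr 6 _∧̇_
infixr 5 _∨̇_
infixr 4 _⇒̇_

data Formula : ℕ → Set where
  _≐_ _∈̇_ : {n : ℕ} → Fin n → Fin n → Formula n
  ⊥̇       : {n : ℕ} → Formula n
  _∧̇_ _∨̇_ _⇒̇_ : {n : ℕ} → Formula n → Formula n → Formula n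
  ∃̇ ∀̇     : {n : ℕ} → Formula (suc n) → Formula n

ext : {n m : ℕ} → (Fin n → Fin m) → Fin (suc n) → Fin (suc m)
ext ρ zero    = zero
ext ρ (suc i) = suc (ρ i)

rename : {n m : ℕ} → (Fin n → Fin m) → Formula n → Formula m
rename ρ (i ≐ j)  = ρ i ≐ ρ j
rename ρ (i ∈̇ j)  = ρ i ∈̇ ρ j
rename ρ ⊥̇        = ⊥̇
rename ρ (φ ∧̇ ψ)  = rename ρ φ ∧̇ rename ρ ψ
rename ρ (φ ∨̇ ψ)  = rename ρ φ ∨̇ rename ρ ψ
rename ρ (φ ⇒̇ ψ)  = rename ρ φ ⇒̇ rename ρ ψ
rename ρ (∃̇ φ)    = ∃̇ (rename (ext ρ) φ)
rename ρ (∀̇ φ)    = ∀̇ (rename (ext ρ) φ)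

weaken : {n : ℕ} → Formula n → Formula (suc n)
weaken = rename suc

inst : {n : ℕ} → Fin n → Fin (suc n) → Fin n
inst i zero    = i
inst i (suc k) = k

_⟨_⟩ : {n : ℕ} → Formula (suc n) → Fin n → Formula n
φ ⟨ i ⟩ = rename (inst i) φ

data Logic : Set where
  intuitionistic classical : Logic

¬̇_ : {n : ℕ} → Formula n → Formula n
¬̇ φ = φ ⇒̇ ⊥̇

infix 2 _⊢[_]_

data _⊢[_]_ : {n : ℕ} → List (Formula n) → Logic → Formula n → Set where
  hyp   : ∀ {n L} {Γ : List (Formula n)} {φ} → φ ∈ᴸ Γ → Γ ⊢[ L ] φ
  ⊥-e   : ∀ {n L} {Γ : List (Formula n)} {φ} → Γ ⊢[ L ] ⊥̇ → Γ ⊢[ L ] φ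
  ∧-i   : ∀ {n L} {Γ : List (Formula n)} {φ ψ} →
          Γ ⊢[ L ] φ → Γ ⊢[ L ] ψ → Γ ⊢[ L ] φ ∧̇ ψ
  ∧-e₁  : ∀ {n L} {Γ : List (Formula n)} {φ ψ} → Γ ⊢[ L ] φ ∧̇ ψ → Γ ⊢[ L ] φ
  ∧-e₂  : ∀ {n L} {Γ : List (Formula n)} {φ ψ} → Γ ⊢[ L ] φ ∧̇ ψ → Γ ⊢[ L ] ψ
  ∨-i₁  : ∀ {n L} {Γ : List (Formula n)} {φ ψ} → Γ ⊢[ L ] φ → Γ ⊢[ L ] φ ∨̇ ψ
  ∨-i₂  : ∀ {n L} {Γ : List (Formula n)} {φ ψ} → Γ ⊢[ L ] ψ → Γ ⊢[ L ] φ ∨̇ ψ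
  ∨-e   : ∀ {n L} {Γ : List (Formula n)} {φ ψ χ} → Γ ⊢[ L ] φ ∨̇ ψ →
          φ ∷ Γ ⊢[ L ] χ → ψ ∷ Γ ⊢[ L ] χ → Γ ⊢[ L ] χ
  ⇒-i   : ∀ {n L} {Γ : List (Formula n)} {φ ψ} → φ ∷ Γ ⊢[ L ] ψ → Γ ⊢[ L ] φ ⇒̇ ψ
  ⇒-e   : ∀ {n L} {Γ : List (Formula n)} {φ ψ} →
          Γ ⊢[ L ] φ ⇒̇ ψ → Γ ⊢[ L ] φ → Γ ⊢[ L ] ψ
  ∀-i   : ∀ {n L} {Γ : List (Formula n)} {φ} →
          map weaken Γ ⊢[ L ] φ → Γ ⊢[ L ] ∀̇ φ
  ∀-e   : ∀ {n L} {Γ : List (Formula n)} {φ} →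
          Γ ⊢[ L ] ∀̇ φ → (i : Fin n) → Γ ⊢[ L ] φ ⟨ i ⟩
  ∃-i   : ∀ {n L} {Γ : List (Formula n)} {φ} →
          (i : Fin n) → Γ ⊢[ L ] φ ⟨ i ⟩ → Γ ⊢[ L ] ∃̇ φ
  ∃-e   : ∀ {n L} {Γ : List (Formula n)} {φ χ} → Γ ⊢[ L ] ∃̇ φ →
          φ ∷ map weaken Γ ⊢[ L ] weaken χ → Γ ⊢[ L ] χ
  ≐-refl  : ∀ {n L} {Γ : List (Formula n)} (i : Fin n) → Γ ⊢[ L ] i ≐ i
  ≐-subst : ∀ {n L} {Γ : List (Formula n)} {i j : Fin n} (φ : Formula (suc n)) →
            Γ ⊢[ L ] i ≐ j → Γ ⊢[ L ] φ ⟨ i ⟩ → Γ ⊢[ L ] φ ⟨ j ⟩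
  dne   : ∀ {n} {Γ : List (Formula n)} {φ} →
          Γ ⊢[ classical ] ¬̇ ¬̇ φ → Γ ⊢[ classical ] φ

module Model (𝔸 : ImplicativeAlgebra) where
  open ImplicativeAlgebra 𝔸

  -- W: well-founded "names": a (small-indexed) family of pairs (t, α(t))
  -- with t ∈ W and α(t) ∈ A  (type-theoretic rendering of W_κ)
  data W : Set₁ where
    sup : (I : Set) → (I → W) → (I → Carrier) → W

  Dom : W → Set
  Dom (sup I _ _) = I

  elt : (α : W) → Dom α → W
  elt (sup _ f _) = f

  val : (α : W) → Dom α → Carrier
  val (sup _ _ a) = a

  infix 7 _∈ᵂ_ _=ᵂ_ _⊆ᵂ_
  _∈ᵂ_ _=ᵂ_ _⊆ᵂ_ : W → W → Carrier
  α ∈ᵂ sup J g b = ∃ᴬ₀ λ j → b j ×ᴬ (g j =ᵂ α)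
  α =ᵂ β = (α ⊆ᵂ β) ×ᴬ (β ⊆ᵂ α)
  sup I f a ⊆ᵂ β = ⋀₀ λ i → a i ⇒ (f i ∈ᵂ β)

  Env : ℕ → Set₁
  Env n = Fin n → W

  _∷ᵉ_ : {n : ℕ} → W → Env n → Env (suc n)
  (β ∷ᵉ ρ) zero    = β
  (β ∷ᵉ ρ) (suc i) = ρ i

  ‖_‖ : {n : ℕ} → Formula n → Env n → Carrier
  ‖ i ≐ j ‖ ρ = ρ i =ᵂ ρ j
  ‖ i ∈̇ j ‖ ρ = ρ i ∈ᵂ ρ j
  ‖ ⊥̇ ‖ ρ = ⊥ᴬ
  ‖ φ ∧̇ ψ ‖ ρ = ‖ φ ‖ ρ ×ᴬ ‖ ψ ‖ ρ
  ‖ φ ∨̇ ψ ‖ ρ = ‖ φ ‖ ρ +ᴬ ‖ ψ ‖ ρ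
  ‖ φ ⇒̇ ψ ‖ ρ = ‖ φ ‖ ρ ⇒ ‖ ψ ‖ ρ
  ‖ ∃̇ φ ‖ ρ = ∃ᴬ λ (β : W) → ‖ φ ‖ (β ∷ᵉ ρ)
  ‖ ∀̇ φ ‖ ρ = ⋀ λ (β : W) → ‖ φ ‖ (β ∷ᵉ ρ)

  Entails : (I : Set₁) → (I → Carrier) → (I → Carrier) → Set
  Entails I f g = Sep (⋀ {I} λ i → f i ⇒ g i)

  infix 2 Entails
  syntax Entails I f g = f ⊢Σ[ I ] g

-- Derivations are interpreted internally to the algebra: a derivation of ψ from hypotheses
-- φ₁ … φₙ shows that ⋀ρ (‖φ₁‖ρ ⇒ … ⇒ ‖φₙ‖ρ ⇒ ‖ψ‖ρ) lies in the separator.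
-- Combinatory completeness (𝐊 and 𝐒 are separated) makes this internal logic closed under
-- the propositional rules, and the impredicative encodings of ×, + and ∃ give exactly their
-- introduction and elimination rules, the quantifiers being meets and joins over W.  The
-- substance lies in the equality rules: reflexivity and transitivity of =ᵂ and the
-- compatibility of ∈ᵂ with =ᵂ are proved by well-founded induction on names, which the
-- algebra realizes with Turing's fixpoint combinator; Leibniz's rule then follows by
-- induction on formulas.  Double negation elimination is Peirce's law, which is separated
-- when the algebra is classical.

module Submission where

open import Defs
open import Data.Nat using (ℕ)
open import Data.List using ([_])
open import Data.Product using (_×_)

open import Level using (Lift; lift; lower)
open import Function using (_∘_; _on_)
open import Data.Unit using (⊤; tt)
open import Data.Nat using (suc)
open import Data.Fin using (Fin; zero; suc)
open import Data.Product using (Σ; _,_; proj₁; proj₂)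
open import Data.List using (List; []; _∷_; map)
open import Data.List.Membership.Propositional using (_∈_)
open import Data.List.Relation.Unary.Any using (here; there)
open import Relation.Binary.PropositionalEquality using (_≡_; refl; sym; cong; cong₂)
open import Relation.Binary.Structures using (IsPartialOrder)
open import Induction.WellFounded using (WellFounded; Acc; acc)
import Relation.Binary.Construct.On as On

module _ (𝔸 : ImplicativeAlgebra) where
  open ImplicativeAlgebra 𝔸
  open Model 𝔸
  open IsPartialOrder ≤-isPartialOrder using (antisym)
    renaming (reflexive to ≤-reflexive; trans to ≤-trans)

  private
    A : Set
    A = Carrier

  ≤-refl : {a : A} → a ≤ a
  ≤-refl = ≤-reflexive refl

  ⋀-mono : {I : Set₁} {f g : I → A} → (∀ i → f i ≤ g i) → ⋀ f ≤ ⋀ g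
  ⋀-mono {f = f} {g} f≤g = ⋀-greatest g (⋀ f) (λ i → ≤-trans (⋀-lower f i) (f≤g i))

  ⋀-cong : {I : Set₁} {f g : I → A} → (∀ i → f i ≡ g i) → ⋀ f ≡ ⋀ g
  ⋀-cong f≡g = antisym (⋀-mono (λ i → ≤-reflexive (f≡g i)))
                       (⋀-mono (λ i → ≤-reflexive (sym (f≡g i))))

  ∃ᴬ-cong : {I : Set₁} {f g : I → A} → (∀ i → f i ≡ g i) → ∃ᴬ f ≡ ∃ᴬ g
  ∃ᴬ-cong f≡g = ⋀-cong λ x → cong (_⇒ lower x) (⋀-cong λ i → cong (_⇒ lower x) (f≡g i))

  ⋀₀-lower : {I : Set} (f : I → A) (i : I) → ⋀₀ f ≤ f i
  ⋀₀-lower f i = ⋀-lower _ (lift i)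

  ⋀-⇒ : {I : Set₁} (a : A) (f : I → A) → ⋀ (λ i → a ⇒ f i) ≤ (a ⇒ ⋀ f)
  ⋀-⇒ a f = ≤-reflexive (sym (⇒-⋀ a f))

  ⋀-mp : {I : Set₁} {f g : I → A} → Sep (⋀ λ i → f i ⇒ g i) → Sep (⋀ f) → Sep (⋀ g)
  ⋀-mp {f = f} {g} sf⇒g sf =
    Sep-mp (Sep-up (≤-trans (⋀-mono λ i → ⇒-mono (⋀-lower f i) ≤-refl) (⋀-⇒ (⋀ f) g)) sf⇒g) sf

  infixl 4 _▸_
  data Ctx (J : Set₁) : Set₁ where
    ε   : Ctx J
    _▸_ : Ctx J → (J → A) → Ctx J

  private variable
    J K : Set₁
    Γ Δ : Ctx J
    a a′ b c d e f g g′ h : J → A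
    α β γ : J → W

  impl : Ctx J → J → A → A
  impl ε       j x = x
  impl (Γ ▸ a) j x = impl Γ j (a j ⇒ x)

  -- Γ ⊩ g is the paper's  Γ₁ × … × Γₙ ⊢_{Σ[J]} g,  with the hypotheses curried.
  infix 2 _⊩_
  record _⊩_ {J : Set₁} (Γ : Ctx J) (g : J → A) : Set where
    constructor realized
    field separated : Sep (⋀ λ j → impl Γ j (g j))
  open _⊩_ public

  impl-mono : (Γ : Ctx J) (j : J) {x y : A} → x ≤ y → impl Γ j x ≤ impl Γ j y
  impl-mono ε       j x≤y = x≤y
  impl-mono (Γ ▸ a) j x≤y = impl-mono Γ j (⇒-mono ≤-refl x≤y)

  ⋀-impl : (Γ : Ctx J) (j : J) {X : Set₁} (k : X → A) →
           ⋀ (λ x → impl Γ j (k x)) ≤ impl Γ j (⋀ k)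
  ⋀-impl ε       j k = ≤-refl
  ⋀-impl (Γ ▸ a) j k = ≤-trans (⋀-impl Γ j (λ x → a j ⇒ k x)) (impl-mono Γ j (⋀-⇒ (a j) k))

  ⊩-mono : (∀ j → g j ≤ g′ j) → Γ ⊩ g → Γ ⊩ g′
  ⊩-mono {Γ = Γ} g≤g′ (realized s) =
    realized (Sep-up (⋀-mono λ j → impl-mono Γ j (g≤g′ j)) s)

  ⊩-≡ : (∀ j → g j ≡ g′ j) → Γ ⊩ g → Γ ⊩ g′
  ⊩-≡ g≡g′ = ⊩-mono (λ j → ≤-reflexive (g≡g′ j))

  lam : Γ ▸ a ⊩ b → Γ ⊩ (λ j → a j ⇒ b j)
  lam (realized s) = realized s

  unlam : Γ ⊩ (λ j → a j ⇒ b j) → Γ ▸ a ⊩ b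
  unlam (realized s) = realized s

  ⊩-K : (a b : J → A) → ε ⊩ (λ j → a j ⇒ b j ⇒ a j)
  ⊩-K a b = realized (Sep-up (⋀-greatest _ 𝐊 λ j →
    ≤-trans (⋀₀-lower _ (a j)) (⋀₀-lower _ (b j))) Sep-K)

  ⊩-S : (a b c : J → A) → ε ⊩ (λ j → (a j ⇒ b j ⇒ c j) ⇒ (a j ⇒ b j) ⇒ a j ⇒ c j)
  ⊩-S a b c = realized (Sep-up (⋀-greatest _ 𝐒 λ j →
    ≤-trans (⋀₀-lower _ (a j)) (≤-trans (⋀₀-lower _ (b j)) (⋀₀-lower _ (c j)))) Sep-S)

  fromClosed : (Γ : Ctx J) → ε ⊩ g → Γ ⊩ g
  fromClosed ε       ⊩g = ⊩g
  fromClosed {g = g} (Γ ▸ a) (realized s) =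
    unlam (fromClosed Γ (realized (⋀-mp (separated (⊩-K g a)) s)))

  mp : Γ ⊩ (λ j → a j ⇒ b j) → Γ ⊩ a → Γ ⊩ b
  mp {Γ = ε}     (realized s⇒) (realized s) = realized (⋀-mp s⇒ s)
  mp {Γ = Γ ▸ c} {a = a} {b = b} ⊩a⇒b ⊩a =
    unlam (mp (mp (fromClosed Γ (⊩-S c a b)) (lam ⊩a⇒b)) (lam ⊩a))

  wk : Γ ⊩ g → Γ ▸ a ⊩ g
  wk {Γ = Γ} {g = g} {a = a} ⊩g = unlam (mp (fromClosed Γ (⊩-K g a)) ⊩g)

  v0 : Γ ▸ a ⊩ a
  v0 {Γ = Γ} {a = a} =
    unlam (fromClosed Γ (mp (mp (⊩-S a (λ j → a j ⇒ a j) a) (⊩-K a _)) (⊩-K a a)))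

  v1 : Γ ▸ a ▸ b ⊩ a
  v1 = wk v0
  v2 : Γ ▸ a ▸ b ▸ c ⊩ a
  v2 = wk v1
  v3 : Γ ▸ a ▸ b ▸ c ▸ d ⊩ a
  v3 = wk v2
  v4 : Γ ▸ a ▸ b ▸ c ▸ d ▸ e ⊩ a
  v4 = wk v3
  v5 : Γ ▸ a ▸ b ▸ c ▸ d ▸ e ▸ f ⊩ a
  v5 = wk v4
  v6 : Γ ▸ a ▸ b ▸ c ▸ d ▸ e ▸ f ▸ g ⊩ a
  v6 = wk v5
  v7 : Γ ▸ a ▸ b ▸ c ▸ d ▸ e ▸ f ▸ g ▸ h ⊩ a
  v7 = wk v6

  _⟦_⟧ : Ctx J → (K → J) → Ctx K
  ε       ⟦ π ⟧ = ε
  (Γ ▸ a) ⟦ π ⟧ = Γ ⟦ π ⟧ ▸ a ∘ π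

  impl-⟦⟧ : (Γ : Ctx J) (π : K → J) (k : K) (x : A) → impl (Γ ⟦ π ⟧) k x ≡ impl Γ (π k) x
  impl-⟦⟧ ε       π k x = refl
  impl-⟦⟧ (Γ ▸ a) π k x = impl-⟦⟧ Γ π k (a (π k) ⇒ x)

  ⊩-reindex : (π : K → J) → Γ ⊩ g → Γ ⟦ π ⟧ ⊩ g ∘ π
  ⊩-reindex {Γ = Γ} {g = g} π (realized s) = realized (Sep-up (⋀-greatest _ _ λ k →
    ≤-trans (⋀-lower _ (π k)) (≤-reflexive (sym (impl-⟦⟧ Γ π k (g (π k)))))) s)

  use : {F : K → A} → ε ⊩ F → (π : J → K) → Γ ⊩ F ∘ π
  use {Γ = Γ} ⊩F π = fromClosed Γ (⊩-reindex π ⊩F)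

  infix 3 _≼_
  data _≼_ {J : Set₁} : Ctx J → Ctx J → Set₁ where
    ε   : ε ≼ ε
    _▸_ : Γ ≼ Δ → (∀ j → a′ j ≤ a j) → Γ ▸ a ≼ Δ ▸ a′

  impl-≼ : Γ ≼ Δ → ∀ j {x y : A} → x ≤ y → impl Γ j x ≤ impl Δ j y
  impl-≼ ε            j x≤y = x≤y
  impl-≼ (Γ≼Δ ▸ a′≤a) j x≤y = impl-≼ Γ≼Δ j (⇒-mono (a′≤a j) x≤y)

  ⊩-≼ : Γ ≼ Δ → (∀ j → g j ≤ g′ j) → Γ ⊩ g → Δ ⊩ g′
  ⊩-≼ Γ≼Δ g≤g′ (realized s) = realized (Sep-up (⋀-mono λ j → impl-≼ Γ≼Δ j (g≤g′ j)) s)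

  ⟦⟧-∘ : (Γ : Ctx J) {π : K → J} {L : Set₁} {τ : L → K} → Γ ⟦ π ⟧ ⟦ τ ⟧ ≼ Γ ⟦ π ∘ τ ⟧
  ⟦⟧-∘ ε       = ε
  ⟦⟧-∘ (Γ ▸ a) = ⟦⟧-∘ Γ ▸ λ _ → ≤-refl

  module _ {X : J → Set₁} {h : (j : J) → X j → A} where

    ⋀-intro : Γ ⟦ proj₁ ⟧ ⊩ (λ p → h (proj₁ p) (proj₂ p)) → Γ ⊩ (λ j → ⋀ (h j))
    ⋀-intro {Γ = Γ} (realized s) = realized (Sep-up (⋀-greatest _ _ λ j → ≤-trans
      (⋀-greatest _ _ λ x → ≤-trans (⋀-lower _ (j , x))
        (≤-reflexive (impl-⟦⟧ Γ proj₁ (j , x) (h j x))))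
      (⋀-impl Γ j (h j))) s)

    ⋀-elim : (t : (j : J) → X j) → Γ ⊩ (λ j → ⋀ (h j)) → Γ ⊩ (λ j → h j (t j))
    ⋀-elim t = ⊩-mono (λ j → ⋀-lower (h j) (t j))

  module _ {X : J → Set} {h : (j : J) → X j → A} where

    ⋀₀-intro : Γ ⟦ proj₁ ⟧ ⊩ (λ p → h (proj₁ p) (proj₂ p)) → Γ ⊩ (λ j → ⋀₀ (h j))
    ⋀₀-intro {Γ = Γ} ⊩h = ⋀-intro
      (⊩-≼ (⟦⟧-∘ Γ) (λ _ → ≤-refl) (⊩-reindex (λ p → proj₁ p , lower (proj₂ p)) ⊩h))

    ⋀₀-elim : (t : (j : J) → X j) → Γ ⊩ (λ j → ⋀₀ (h j)) → Γ ⊩ (λ j → h j (t j))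
    ⋀₀-elim t = ⋀-elim (λ j → lift (t j))

  ×-intro : Γ ⊩ a → Γ ⊩ b → Γ ⊩ (λ j → a j ×ᴬ b j)
  ×-intro {a = a} {b = b} ⊩a ⊩b = ⋀₀-intro {h = λ j x → (a j ⇒ b j ⇒ x) ⇒ x}
    (lam (mp (mp v0 (wk (⊩-reindex proj₁ ⊩a))) (wk (⊩-reindex proj₁ ⊩b))))

  ×-elim : Γ ⊩ (λ j → a j ×ᴬ b j) → Γ ▸ a ▸ b ⊩ c → Γ ⊩ c
  ×-elim {a = a} {b = b} {c = c} ⊩a×b ⊩c =
    mp (⋀₀-elim {h = λ j x → (a j ⇒ b j ⇒ x) ⇒ x} c ⊩a×b) (lam (lam ⊩c))

  ×-uncurry : Γ ▸ a ▸ b ⊩ c → Γ ▸ (λ j → a j ×ᴬ b j) ⊩ c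
  ×-uncurry ⊩c = ×-elim v0 (mp (mp (wk (wk (wk (lam (lam ⊩c))))) v1) v0)

  +-intro₁ : Γ ⊩ a → Γ ⊩ (λ j → a j +ᴬ b j)
  +-intro₁ {a = a} {b = b} ⊩a = ⋀₀-intro {h = λ j x → (a j ⇒ x) ⇒ (b j ⇒ x) ⇒ x}
    (lam (lam (mp v1 (wk (wk (⊩-reindex proj₁ ⊩a))))))

  +-intro₂ : Γ ⊩ b → Γ ⊩ (λ j → a j +ᴬ b j)
  +-intro₂ {b = b} {a = a} ⊩b = ⋀₀-intro {h = λ j x → (a j ⇒ x) ⇒ (b j ⇒ x) ⇒ x}
    (lam (lam (mp v0 (wk (wk (⊩-reindex proj₁ ⊩b))))))

  +-elim : Γ ⊩ (λ j → a j +ᴬ b j) → Γ ▸ a ⊩ c → Γ ▸ b ⊩ c → Γ ⊩ c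
  +-elim {a = a} {b = b} {c = c} ⊩a+b ⊩c₁ ⊩c₂ =
    mp (mp (⋀₀-elim {h = λ j x → (a j ⇒ x) ⇒ (b j ⇒ x) ⇒ x} c ⊩a+b) (lam ⊩c₁)) (lam ⊩c₂)

  ⊥-elim : Γ ⊩ (λ _ → ⊥ᴬ) → Γ ⊩ a
  ⊥-elim {a = a} = ⊩-mono (λ j → ⋀₀-lower _ (a j))

  module _ {X : J → Set₁} {F : (j : J) → X j → A} where

    ∃-intro : (t : (j : J) → X j) → Γ ⊩ (λ j → F j (t j)) → Γ ⊩ (λ j → ∃ᴬ (F j))
    ∃-intro t ⊩F = ⋀₀-intro {h = λ j x → ⋀ (λ i → F j i ⇒ x) ⇒ x}
      (lam (mp (⋀-elim (t ∘ proj₁) v0) (wk (⊩-reindex proj₁ ⊩F))))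

    ∃-elim : Γ ⊩ (λ j → ∃ᴬ (F j)) →
             Γ ⟦ proj₁ ⟧ ▸ (λ p → F (proj₁ p) (proj₂ p)) ⊩ c ∘ proj₁ → Γ ⊩ c
    ∃-elim {c = c} ⊩∃ ⊩c = mp (⋀₀-elim {h = λ j x → ⋀ (λ i → F j i ⇒ x) ⇒ x} c ⊩∃)
      (⋀-intro {h = λ j i → F j i ⇒ c j} (lam ⊩c))

  module _ {X : J → Set} {F : (j : J) → X j → A} where

    ∃₀-intro : (t : (j : J) → X j) → Γ ⊩ (λ j → F j (t j)) → Γ ⊩ (λ j → ∃ᴬ₀ (F j))
    ∃₀-intro t = ∃-intro (λ j → lift (t j))

    ∃₀-elim : Γ ⊩ (λ j → ∃ᴬ₀ (F j)) →
              Γ ⟦ proj₁ ⟧ ▸ (λ p → F (proj₁ p) (proj₂ p)) ⊩ c ∘ proj₁ → Γ ⊩ c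
    ∃₀-elim {Γ = Γ} ⊩∃ ⊩c = ∃-elim ⊩∃ (⊩-≼ (⟦⟧-∘ Γ ▸ λ _ → ≤-refl) (λ _ → ≤-refl)
      (⊩-reindex (λ p → proj₁ p , lower (proj₂ p)) ⊩c))

  infixl 9 _·_
  _·_ : A → A → A
  x · y = ⋀₀ {Σ A (λ z → x ≤ (y ⇒ z))} proj₁

  ·-≤ : {x y z : A} → x ≤ (y ⇒ z) → x · y ≤ z
  ·-≤ {z = z} x≤y⇒z = ⋀₀-lower proj₁ (z , x≤y⇒z)

  ≤-⇒· : {x y : A} → x ≤ (y ⇒ x · y)
  ≤-⇒· {y = y} = ≤-trans (⋀-greatest _ _ (λ i → proj₂ (lower i))) (⋀-⇒ y _)

  ·-mono : {x x′ y y′ : A} → x ≤ x′ → y ≤ y′ → x · y ≤ x′ · y′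
  ·-mono x≤x′ y≤y′ = ⋀-greatest _ _ λ i →
    ·-≤ (≤-trans x≤x′ (≤-trans (proj₂ (lower i)) (⇒-mono y≤y′ ≤-refl)))

  Sep-· : {x y : A} → Sep x → Sep y → Sep (x · y)
  Sep-· sx sy = Sep-mp (Sep-up ≤-⇒· sx) sy

  𝐊-β : {x y : A} → 𝐊 · x · y ≤ x
  𝐊-β {x} {y} = ·-≤ (·-≤ (≤-trans (⋀₀-lower _ x) (⋀₀-lower _ y)))

  𝐒-β : {x y z : A} → 𝐒 · x · y · z ≤ x · z · (y · z)
  𝐒-β {x} {y} {z} = ·-≤ (·-≤ (·-≤ (≤-trans (⋀₀-lower _ z) (≤-trans (⋀₀-lower _ (y · z))
    (≤-trans (⋀₀-lower _ (x · z · (y · z)))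
      (⇒-mono (≤-trans ≤-⇒· (⇒-mono ≤-refl ≤-⇒·)) (⇒-mono ≤-⇒· ≤-refl)))))))

  𝐈 : A
  𝐈 = 𝐒 · 𝐊 · 𝐊

  𝐈-β : {x : A} → 𝐈 · x ≤ x
  𝐈-β = ≤-trans 𝐒-β 𝐊-β

  -- Turing's fixpoint combinator Θ = 𝐀 𝐀, where 𝐀 = λxy. y (x x y).
  𝐀 : A
  𝐀 = 𝐒 · (𝐊 · (𝐒 · 𝐈)) · (𝐒 · 𝐈 · 𝐈)

  𝐀-β : {x y : A} → 𝐀 · x · y ≤ y · (x · x · y)
  𝐀-β {x} {y} = ≤-trans (·-mono 𝐀x ≤-refl) (≤-trans 𝐒-β (·-mono 𝐈-β ≤-refl))
    where
    𝐀x : 𝐀 · x ≤ 𝐒 · 𝐈 · (x · x)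
    𝐀x = ≤-trans 𝐒-β (·-mono 𝐊-β (≤-trans 𝐒-β (·-mono 𝐈-β 𝐈-β)))

  Θ : A
  Θ = 𝐀 · 𝐀

  Θ-β : {x : A} → Θ · x ≤ x · (Θ · x)
  Θ-β = 𝐀-β

  Sep-Θ : Sep Θ
  Sep-Θ = Sep-· Sep-𝐀 Sep-𝐀
    where
    Sep-𝐈 : Sep 𝐈
    Sep-𝐈 = Sep-· (Sep-· Sep-S Sep-K) Sep-K
    Sep-𝐀 : Sep 𝐀
    Sep-𝐀 = Sep-· (Sep-· Sep-S (Sep-· Sep-K (Sep-· Sep-S Sep-𝐈)))
                  (Sep-· (Sep-· Sep-S Sep-𝐈) Sep-𝐈)

  Below : (_<_ : J → J → Set₁) → (J → A) → J → A
  Below {J = J} _<_ P j = ⋀ {Σ J (λ k → k < j)} (P ∘ proj₁)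

  ⊩-wfInduction : (_<_ : J → J → Set₁) → WellFounded _<_ → {P : J → A} →
                  ε ▸ Below _<_ P ⊩ P → ε ⊩ P
  ⊩-wfInduction _<_ wf {P} (realized s) =
    realized (Sep-up (⋀-greatest _ _ λ j → Θ·step≤ j (wf j)) (Sep-· Sep-Θ s))
    where
    step : A
    step = ⋀ λ j → Below _<_ P j ⇒ P j
    -- Recursion along Acc, unfolding Θ · step ≤ step · (Θ · step) once per level.
    Θ·step≤ : ∀ j → Acc _<_ j → Θ · step ≤ P j
    Θ·step≤ j (acc rs) = ≤-trans Θ-β (·-≤ (≤-trans (⋀-lower _ j)
      (⇒-mono (⋀-greatest _ _ λ k → Θ·step≤ (proj₁ k) (rs (proj₂ k))) ≤-refl)))

  _≺_ : W → W → Set₁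
  β ≺ α = Σ (Dom α) (λ i → elt α i ≡ β)

  ≺-wellFounded : WellFounded _≺_
  ≺-wellFounded (sup I f a) = acc λ { (i , refl) → ≺-wellFounded (f i) }

  ⊆ᵂ-unfold : (α β : W) → α ⊆ᵂ β ≡ ⋀₀ (λ i → val α i ⇒ elt α i ∈ᵂ β)
  ⊆ᵂ-unfold (sup I f a) β = refl

  ∈ᵂ-unfold : (α β : W) → α ∈ᵂ β ≡ ∃ᴬ₀ (λ j → val β j ×ᴬ elt β j =ᵂ α)
  ∈ᵂ-unfold α (sup I f a) = refl

  module _ {α β : J → W} where

    ⊆ᵂ-intro : Γ ⟦ proj₁ ⟧ ▸ (λ p → val (α (proj₁ p)) (proj₂ p)) ⊩
                 (λ p → elt (α (proj₁ p)) (proj₂ p) ∈ᵂ β (proj₁ p)) →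
               Γ ⊩ (λ j → α j ⊆ᵂ β j)
    ⊆ᵂ-intro ⊩∈ = ⊩-≡ (λ j → sym (⊆ᵂ-unfold (α j) (β j))) (⋀₀-intro (lam ⊩∈))

    ⊆ᵂ-elim : Γ ⊩ (λ j → α j ⊆ᵂ β j) → (i : (j : J) → Dom (α j)) →
              Γ ⊩ (λ j → val (α j) (i j)) → Γ ⊩ (λ j → elt (α j) (i j) ∈ᵂ β j)
    ⊆ᵂ-elim ⊩⊆ i ⊩val = mp (⋀₀-elim {h = λ j i → val (α j) i ⇒ elt (α j) i ∈ᵂ β j} i
      (⊩-≡ (λ j → ⊆ᵂ-unfold (α j) (β j)) ⊩⊆)) ⊩val

    ∈ᵂ-intro : (i : (j : J) → Dom (β j)) → Γ ⊩ (λ j → val (β j) (i j)) →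
               Γ ⊩ (λ j → elt (β j) (i j) =ᵂ α j) → Γ ⊩ (λ j → α j ∈ᵂ β j)
    ∈ᵂ-intro i ⊩val ⊩= = ⊩-≡ (λ j → sym (∈ᵂ-unfold (α j) (β j)))
      (∃₀-intro {F = λ j i → val (β j) i ×ᴬ elt (β j) i =ᵂ α j} i (×-intro ⊩val ⊩=))

    ∈ᵂ-elim : Γ ⊩ (λ j → α j ∈ᵂ β j) →
              Γ ⟦ proj₁ ⟧ ▸ (λ p → val (β (proj₁ p)) (proj₂ p))
                          ▸ (λ p → elt (β (proj₁ p)) (proj₂ p) =ᵂ α (proj₁ p)) ⊩ c ∘ proj₁ →
              Γ ⊩ c
    ∈ᵂ-elim ⊩∈ ⊩c = ∃₀-elim {F = λ j i → val (β j) i ×ᴬ elt (β j) i =ᵂ α j}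
      (⊩-≡ (λ j → ∈ᵂ-unfold (α j) (β j)) ⊩∈) (×-uncurry ⊩c)

  =ᵂ-refl : ε ⊩ (λ α → α =ᵂ α)
  =ᵂ-refl = ⊩-wfInduction _≺_ ≺-wellFounded (×-intro ⊆ᵂ-refl ⊆ᵂ-refl)
    where
    ⊆ᵂ-refl : ε ▸ Below _≺_ (λ α → α =ᵂ α) ⊩ (λ α → α ⊆ᵂ α)
    ⊆ᵂ-refl = ⊆ᵂ-intro {α = λ α → α} {β = λ α → α} (∈ᵂ-intro {β = proj₁} proj₂ v0
      (⋀-elim (λ { (α , i) → elt α i , i , refl }) v1))

  =ᵂ-sym : ε ⊩ (λ (t : W × W) → proj₁ t =ᵂ proj₂ t ⇒ proj₂ t =ᵂ proj₁ t)
  =ᵂ-sym = lam (×-elim v0 (×-intro v0 v1))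

  π₁ π₂ π₃ : W × W × W → W
  π₁ = proj₁
  π₂ = proj₁ ∘ proj₂
  π₃ = proj₂ ∘ proj₂

  TransitiveAt : W × W × W → A
  TransitiveAt (α , β , γ) = α =ᵂ β ⇒ β =ᵂ γ ⇒ α =ᵂ γ

  -- Induction on the middle name suffices: both halves of the induction step only need
  -- transitivity for triples whose middle name is an element of the current middle name.
  _⊏_ : W × W × W → W × W × W → Set₁
  _⊏_ = _≺_ on π₂

  -- From xᵢ ∈ y and y ⊆ z get yⱼ =ᵂ xᵢ and z_k =ᵂ yⱼ; the hypothesis at (z_k, yⱼ, xᵢ) joins them.
  ⊆ᵂ-trans-step :
    ε ⊩ (λ t → Below _⊏_ TransitiveAt t ⇒ π₁ t ⊆ᵂ π₂ t ⇒ π₂ t ⊆ᵂ π₃ t ⇒ π₁ t ⊆ᵂ π₃ t)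
  ⊆ᵂ-trans-step = lam (lam (lam (⊆ᵂ-intro {α = π₁} {β = π₃}
    (∈ᵂ-elim {α = xᵢ} {β = π₂ ∘ proj₁} (⊆ᵂ-elim {α = π₁ ∘ proj₁} v2 proj₂ v0)
    (∈ᵂ-elim {α = yⱼ} {β = π₃ ∘ proj₁ ∘ proj₁}
      (⊆ᵂ-elim {α = π₂ ∘ proj₁ ∘ proj₁} v3 proj₂ v1)
    (∈ᵂ-intro {β = π₃ ∘ proj₁ ∘ proj₁ ∘ proj₁} proj₂ v1
      (mp (mp (⋀-elim below v7) v0) v2)))))))
    where
    xᵢ : Σ (W × W × W) (Dom ∘ π₁) → W
    xᵢ (t , i) = elt (π₁ t) i
    yⱼ : Σ (Σ (W × W × W) (Dom ∘ π₁)) (Dom ∘ π₂ ∘ proj₁) → W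
    yⱼ ((t , _) , j) = elt (π₂ t) j
    below : (p : Σ (Σ (Σ (W × W × W) (Dom ∘ π₁)) (Dom ∘ π₂ ∘ proj₁))
                   (Dom ∘ π₃ ∘ proj₁ ∘ proj₁)) →
            Σ (W × W × W) (_⊏ proj₁ (proj₁ (proj₁ p)))
    below (((t , i) , j) , k) = (elt (π₃ t) k , elt (π₂ t) j , elt (π₁ t) i) , j , refl

  =ᵂ-trans : ε ⊩ TransitiveAt
  =ᵂ-trans = ⊩-wfInduction _⊏_ (On.wellFounded π₂ ≺-wellFounded)
    (lam (lam (×-elim v1 (×-elim v2 (×-intro
      (mp (mp (mp (use ⊆ᵂ-trans-step (λ t → t)) v6) v3) v1)
      (mp (mp (mp (use ⊆ᵂ-trans-step (λ (α , β , γ) → γ , β , α)) v6) v0) v2))))))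

  ∈ᵂ-respˡ : ε ⊩ (λ (α , β , γ) → α =ᵂ β ⇒ α ∈ᵂ γ ⇒ β ∈ᵂ γ)
  ∈ᵂ-respˡ = lam (lam (∈ᵂ-elim {β = π₃} v0 (∈ᵂ-intro {β = π₃ ∘ proj₁} proj₂ v1
    (mp (mp (use =ᵂ-trans (λ ((α , β , γ) , k) → elt γ k , α , β)) v0) v3))))

  ∈ᵂ-respʳ : ε ⊩ (λ (α , β , γ) → α =ᵂ β ⇒ γ ∈ᵂ α ⇒ γ ∈ᵂ β)
  ∈ᵂ-respʳ = lam (lam (×-elim v1 (∈ᵂ-elim {α = π₃} {β = π₁} v2
    (∈ᵂ-elim {α = αᵢ} {β = π₂ ∘ proj₁} (⊆ᵂ-elim {α = π₁ ∘ proj₁} v3 proj₂ v1)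
    (∈ᵂ-intro {β = π₂ ∘ proj₁ ∘ proj₁} proj₂ v1
      (mp (mp (use =ᵂ-trans (λ (((α , β , γ) , i) , j) → elt β j , elt α i , γ)) v0) v2))))))
    where
    αᵢ : Σ (W × W × W) (Dom ∘ π₁) → W
    αᵢ ((α , _ , _) , i) = elt α i

  ⊩-sym : Γ ⊩ (λ j → α j =ᵂ β j) → Γ ⊩ (λ j → β j =ᵂ α j)
  ⊩-sym {α = α} {β = β} = mp (use =ᵂ-sym (λ j → α j , β j))

  ⊩-trans : Γ ⊩ (λ j → α j =ᵂ β j) → Γ ⊩ (λ j → β j =ᵂ γ j) → Γ ⊩ (λ j → α j =ᵂ γ j)
  ⊩-trans {α = α} {β = β} {γ = γ} α=β =
    mp (mp (use =ᵂ-trans (λ j → α j , β j , γ j)) α=β)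

  ⊩-∈-respˡ : Γ ⊩ (λ j → α j =ᵂ β j) → Γ ⊩ (λ j → α j ∈ᵂ γ j) → Γ ⊩ (λ j → β j ∈ᵂ γ j)
  ⊩-∈-respˡ {α = α} {β = β} {γ = γ} α=β =
    mp (mp (use ∈ᵂ-respˡ (λ j → α j , β j , γ j)) α=β)

  ⊩-∈-respʳ : Γ ⊩ (λ j → α j =ᵂ β j) → Γ ⊩ (λ j → γ j ∈ᵂ α j) → Γ ⊩ (λ j → γ j ∈ᵂ β j)
  ⊩-∈-respʳ {α = α} {β = β} {γ = γ} α=β =
    mp (mp (use ∈ᵂ-respʳ (λ j → α j , β j , γ j)) α=β)

  _!_ : {n : ℕ} → (J → Env n) → Fin n → J → W
  (ρ ! k) j = ρ j k

  ∷ᵉ-cong : {n : ℕ} {ρ ρ′ : J → Env n} {Δ : Ctx (J × W)} →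
            (∀ k → Δ ⊩ (λ p → ρ (proj₁ p) k =ᵂ ρ′ (proj₁ p) k)) →
            ∀ k → Δ ⊩ (λ p → (proj₂ p ∷ᵉ ρ (proj₁ p)) k =ᵂ (proj₂ p ∷ᵉ ρ′ (proj₁ p)) k)
  ∷ᵉ-cong ρ=ρ′ zero    = use =ᵂ-refl proj₂
  ∷ᵉ-cong ρ=ρ′ (suc k) = ρ=ρ′ k

  ‖‖-cong : {n : ℕ} (φ : Formula n) {ρ ρ′ : J → Env n} →
            (∀ k → Γ ⊩ (λ j → ρ j k =ᵂ ρ′ j k)) → Γ ⊩ (λ j → ‖ φ ‖ (ρ j)) → Γ ⊩ (λ j → ‖ φ ‖ (ρ′ j))
  ‖‖-cong (i ≐ k) {ρ} {ρ′} ρ=ρ′ ⊩φ =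
    ⊩-trans {β = ρ ! i} (⊩-sym {α = ρ ! i} {ρ′ ! i} (ρ=ρ′ i))
                        (⊩-trans {β = ρ ! k} ⊩φ (ρ=ρ′ k))
  ‖‖-cong (i ∈̇ k) {ρ} {ρ′} ρ=ρ′ ⊩φ =
    ⊩-∈-respʳ {α = ρ ! k} {ρ′ ! k} (ρ=ρ′ k)
              (⊩-∈-respˡ {α = ρ ! i} {ρ′ ! i} {ρ ! k} (ρ=ρ′ i) ⊩φ)
  ‖‖-cong ⊥̇       ρ=ρ′ ⊩φ = ⊩φ
  ‖‖-cong (φ ∧̇ ψ) ρ=ρ′ ⊩φ =
    ×-elim ⊩φ (×-intro (‖‖-cong φ (wk ∘ wk ∘ ρ=ρ′) v1) (‖‖-cong ψ (wk ∘ wk ∘ ρ=ρ′) v0))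
  ‖‖-cong (φ ∨̇ ψ) ρ=ρ′ ⊩φ =
    +-elim ⊩φ (+-intro₁ (‖‖-cong φ (wk ∘ ρ=ρ′) v0)) (+-intro₂ (‖‖-cong ψ (wk ∘ ρ=ρ′) v0))
  ‖‖-cong {Γ = Γ} (φ ⇒̇ ψ) {ρ} {ρ′} ρ=ρ′ ⊩φ =
    lam (‖‖-cong ψ (wk ∘ ρ=ρ′) (mp (wk ⊩φ) (‖‖-cong φ ρ′=ρ v0)))
    where
    ρ′=ρ : ∀ k → Γ ▸ (λ j → ‖ φ ‖ (ρ′ j)) ⊩ (λ j → ρ′ j k =ᵂ ρ j k)
    ρ′=ρ k = wk (⊩-sym {α = ρ ! k} {ρ′ ! k} (ρ=ρ′ k))
  ‖‖-cong (∃̇ φ) ρ=ρ′ ⊩φ =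
    ∃-elim ⊩φ (∃-intro proj₂ (‖‖-cong φ (∷ᵉ-cong (wk ∘ ⊩-reindex proj₁ ∘ ρ=ρ′)) v0))
  ‖‖-cong (∀̇ φ) ρ=ρ′ ⊩φ =
    ⋀-intro (‖‖-cong φ (∷ᵉ-cong (⊩-reindex proj₁ ∘ ρ=ρ′)) (⋀-elim proj₂ (⊩-reindex proj₁ ⊩φ)))

  ∷ᵉ-ext : {n m : ℕ} {σ : Fin n → Fin m} {ρ : Env m} {ρ′ : Env n} (β : W) →
           (∀ k → ρ (σ k) ≡ ρ′ k) → ∀ k → (β ∷ᵉ ρ) (ext σ k) ≡ (β ∷ᵉ ρ′) k
  ∷ᵉ-ext β ρσ≡ρ′ zero    = refl
  ∷ᵉ-ext β ρσ≡ρ′ (suc k) = ρσ≡ρ′ k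

  ‖rename‖ : {n m : ℕ} (σ : Fin n → Fin m) (φ : Formula n) {ρ : Env m} {ρ′ : Env n} →
             (∀ k → ρ (σ k) ≡ ρ′ k) → ‖ rename σ φ ‖ ρ ≡ ‖ φ ‖ ρ′
  ‖rename‖ σ (i ≐ k) ρσ≡ρ′ = cong₂ _=ᵂ_ (ρσ≡ρ′ i) (ρσ≡ρ′ k)
  ‖rename‖ σ (i ∈̇ k) ρσ≡ρ′ = cong₂ _∈ᵂ_ (ρσ≡ρ′ i) (ρσ≡ρ′ k)
  ‖rename‖ σ ⊥̇       ρσ≡ρ′ = refl
  ‖rename‖ σ (φ ∧̇ ψ) ρσ≡ρ′ = cong₂ _×ᴬ_ (‖rename‖ σ φ ρσ≡ρ′) (‖rename‖ σ ψ ρσ≡ρ′)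
  ‖rename‖ σ (φ ∨̇ ψ) ρσ≡ρ′ = cong₂ _+ᴬ_ (‖rename‖ σ φ ρσ≡ρ′) (‖rename‖ σ ψ ρσ≡ρ′)
  ‖rename‖ σ (φ ⇒̇ ψ) ρσ≡ρ′ = cong₂ _⇒_ (‖rename‖ σ φ ρσ≡ρ′) (‖rename‖ σ ψ ρσ≡ρ′)
  ‖rename‖ σ (∃̇ φ)   ρσ≡ρ′ = ∃ᴬ-cong λ β → ‖rename‖ (ext σ) φ (∷ᵉ-ext β ρσ≡ρ′)
  ‖rename‖ σ (∀̇ φ)   ρσ≡ρ′ = ⋀-cong λ β → ‖rename‖ (ext σ) φ (∷ᵉ-ext β ρσ≡ρ′)

  ‖weaken‖ : {n : ℕ} (φ : Formula n) (β : W) (ρ : Env n) → ‖ weaken φ ‖ (β ∷ᵉ ρ) ≡ ‖ φ ‖ ρ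
  ‖weaken‖ φ β ρ = ‖rename‖ suc φ (λ _ → refl)

  ‖⟨⟩‖ : {n : ℕ} (φ : Formula (suc n)) (i : Fin n) (ρ : Env n) →
         ‖ φ ⟨ i ⟩ ‖ ρ ≡ ‖ φ ‖ (ρ i ∷ᵉ ρ)
  ‖⟨⟩‖ φ i ρ = ‖rename‖ (inst i) φ λ { zero → refl ; (suc k) → refl }

  Hyps : {n : ℕ} → List (Formula n) → Ctx (Env n)
  Hyps []      = ε
  Hyps (φ ∷ Γ) = Hyps Γ ▸ ‖ φ ‖

  hyp-⊩ : {n : ℕ} {Γ : List (Formula n)} {φ : Formula n} → φ ∈ Γ → Hyps Γ ⊩ ‖ φ ‖
  hyp-⊩ (here refl) = v0
  hyp-⊩ (there φ∈Γ) = wk (hyp-⊩ φ∈Γ)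

  extendᵉ : {n : ℕ} → Env n × W → Env (suc n)
  extendᵉ (ρ , β) = β ∷ᵉ ρ

  Hyps-weaken : {n : ℕ} (Γ : List (Formula n)) →
                Hyps (map weaken Γ) ⟦ extendᵉ ⟧ ≼ Hyps Γ ⟦ proj₁ ⟧
  Hyps-weaken []      = ε
  Hyps-weaken (ψ ∷ Γ) =
    Hyps-weaken Γ ▸ λ p → ≤-reflexive (sym (‖weaken‖ ψ (proj₂ p) (proj₁ p)))

  ⊩-peirce : Classical 𝔸 → (a b : J → A) → ε ⊩ (λ j → ((a j ⇒ b j) ⇒ a j) ⇒ a j)
  ⊩-peirce cl a b = realized (Sep-up (⋀-greatest _ _ λ j →
    ≤-trans (⋀₀-lower _ (a j)) (⋀₀-lower _ (b j))) cl)

  Admissible : Logic → Set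
  Admissible intuitionistic = ⊤
  Admissible classical      = Classical 𝔸

  sound : {n : ℕ} {L : Logic} {Γ : List (Formula n)} {φ : Formula n} →
          Admissible L → Γ ⊢[ L ] φ → Hyps Γ ⊩ ‖ φ ‖
  sound adm (hyp φ∈Γ)   = hyp-⊩ φ∈Γ
  sound adm (⊥-e d)     = ⊥-elim (sound adm d)
  sound adm (∧-i d e)   = ×-intro (sound adm d) (sound adm e)
  sound adm (∧-e₁ d)    = ×-elim (sound adm d) v1
  sound adm (∧-e₂ d)    = ×-elim (sound adm d) v0
  sound adm (∨-i₁ d)    = +-intro₁ (sound adm d)
  sound adm (∨-i₂ d)    = +-intro₂ (sound adm d)
  sound adm (∨-e d e f) = +-elim (sound adm d) (sound adm e) (sound adm f)
  sound adm (⇒-i d)     = lam (sound adm d)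
  sound adm (⇒-e d e)   = mp (sound adm d) (sound adm e)
  sound adm (∀-i {Γ = Γ} d) =
    ⋀-intro (⊩-≼ (Hyps-weaken Γ) (λ _ → ≤-refl) (⊩-reindex extendᵉ (sound adm d)))
  sound adm (∀-e {φ = φ} d i) =
    ⊩-≡ (λ ρ → sym (‖⟨⟩‖ φ i ρ)) (⋀-elim (λ ρ → ρ i) (sound adm d))
  sound adm (∃-i {φ = φ} i d) =
    ∃-intro (λ ρ → ρ i) (⊩-≡ (‖⟨⟩‖ φ i) (sound adm d))
  sound adm (∃-e {Γ = Γ} {χ = χ} d e) =
    ∃-elim (sound adm d) (⊩-≼ (Hyps-weaken Γ ▸ λ _ → ≤-refl)
      (λ p → ≤-reflexive (‖weaken‖ χ (proj₂ p) (proj₁ p)))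
      (⊩-reindex extendᵉ (sound adm e)))
  sound adm (≐-refl i)  = use =ᵂ-refl (λ ρ → ρ i)
  sound adm (≐-subst {Γ = Γ} {i = i} {j} φ d e) =
    ⊩-≡ (λ ρ → sym (‖⟨⟩‖ φ j ρ)) (‖‖-cong φ ρᵢ=ρⱼ (⊩-≡ (‖⟨⟩‖ φ i) (sound adm e)))
    where
    ρᵢ=ρⱼ : ∀ k → Hyps Γ ⊩ (λ ρ → (ρ i ∷ᵉ ρ) k =ᵂ (ρ j ∷ᵉ ρ) k)
    ρᵢ=ρⱼ zero    = sound adm d
    ρᵢ=ρⱼ (suc k) = use =ᵂ-refl (λ ρ → ρ k)
  sound cl (dne {Γ = Γ} {φ = φ} d) =
    mp (fromClosed (Hyps Γ) (⊩-peirce cl ‖ φ ‖ (λ _ → ⊥ᴬ))) (lam (⊥-elim (mp (wk (sound cl d)) v0)))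

lemma4p4 : (𝔸 : ImplicativeAlgebra) →
    let open Model 𝔸 in
    ((n : ℕ) (φ ψ : Formula n) →
      [ φ ] ⊢[ intuitionistic ] ψ → ‖ φ ‖ ⊢Σ[ Env n ] ‖ ψ ‖)
    ×
    (Classical 𝔸 → (n : ℕ) (φ ψ : Formula n) →
      [ φ ] ⊢[ classical ] ψ → ‖ φ ‖ ⊢Σ[ Env n ] ‖ ψ ‖)
lemma4p4 𝔸 = (λ n φ ψ d → separated (sound 𝔸 tt d))
           , (λ cl n φ ψ d → separated (sound 𝔸 cl d))
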